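{- Let $(P,\mathbf c)$ be a generic linear program with $P\subset\mathbb R^d$ a $d$-dimensional polytope whose graph is complete, with vertices $\mathbf u_1,\dots,\mathbf u_n$ labelled so that $\langle\mathbf c,\mathbf u_i\rangle<\langle\mathbf c,\mathbf u_j\rangle$ for $i<j$, and let $m=n-1$. For any two generic $\boldsymbol\omega,\boldsymbol\omega'\in\mathbb R^d$, we have $\mathcal A^{\boldsymbol\omega}=\mathcal A^{\boldsymbol\omega'}$ if and only if $\pi^{\boldsymbol\omega}\equiv_{\mathrm{sylv}}\pi^{\boldsymbol\omega'}$.
   Context: A generic linear program is a pair $(P,\mathbf c)$ where $P\subset\mathbb R^d$ is a $d$-dimensional polytope and $\mathbf c\in\mathbb R^d$ satisfies $\langle\mathbf c,\mathbf u\rangle\neq\langle\mathbf c,\mathbf v\rangle$ for every edge $\mathbf u\mathbf v$ of $P$. A vertex $\mathbf v$ is an improving neighbor of a vertex $\mathbf u$ if $\mathbf u\mathbf v$ is an edge and $\langle\mathbf c,\mathbf u\rangle<\langle\mathbf c,\mathbf v\rangle$. For distinct vertices $\mathbf u,\mathbf v$ and $\boldsymbol\omega\in\mathbb R^d$ set $\rho^{\boldsymbol\omega}(\mathbf u,\mathbf v)=\frac{\langle\boldsymbol\omega,\mathbf v-\mathbf u\rangle}{\langle\mathbf c,\mathbf v-\mathbf u\rangle}$. For $\boldsymbol\omega$ linearly independent of $\mathbf c$, set $\tau^{\boldsymbol\omega}(\mathbf u)=\max\{\rho^{\boldsymbol\omega}(\mathbf u,\mathbf v):\mathbf v\text{ improving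 neighbor of }\mathbf u\}$ for $\mathbf u\neq\mathbf u_n$, and $\tau^{\boldsymbol\omega}(\mathbf u_n)=-\infty$. The direction $\boldsymbol\omega$ is generic if for every vertex $\mathbf u\ne\mathbf u_n$ this maximum is attained by a unique improving neighbor, denoted $\mathcal A^{\boldsymbol\omega}(\mathbf u)$; also $\mathcal A^{\boldsymbol\omega}(\mathbf u_n)=\mathbf u_n$. Vertices are identified with their indices, so $\tau^{\boldsymbol\omega}$ and $\mathcal A^{\boldsymbol\omega}$ are maps on $[n]$. For generic $\boldsymbol\omega$, $\pi^{\boldsymbol\omega}$ denotes the permutation of $[m]$ with $\tau^{\boldsymbol\omega}(\pi^{\boldsymbol\omega}_1)<\dots<\tau^{\boldsymbol\omega}(\pi^{\boldsymbol\omega}_m)$. The sylvester congruence $\equiv_{\mathrm{sylv}}$ is the equivalence relation on permutations of $[m]$ (written as words) generated by the rewriting rule $UjVikW\equiv_{\mathrm{sylv}}UjVkiW$ for letters $1\le i<j<k\le m$ and words $U,V,W$ on $[m]$. -}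

module Defs where

open import Level using (0ℓ)
open import Data.Nat using (ℕ; zero; suc)
open import Data.Fin using (Fin; zero; suc; inject₁; fromℕ) renaming (_<_ to _<ᶠ_)
open import Data.List using (List; []; _∷_; _++_; map; allFin)
open import Data.List.Relation.Unary.Linked using (Linked)
open import Data.List.Relation.Binary.Permutation.Propositional using (_↭_)
open import Data.Product using (Σ; ∃; _×_; _,_)
open import Relation.Binary.PropositionalEquality using (_≡_; _≢_)
open import Relation.Binary.Core using (Rel)
open import Relation.Binary.Structures using (IsStrictTotalOrder)
open import Relation.Binary.Construct.Closure.Equivalence using (EqClosure)
open import Algebra.Structures using (IsCommutativeRing)
open import Data.Sum using (_⊎_)

-- The real numbers, axiomatised as a complete ordered field
-- (any two models are isomorphic, so quantifying over all models is
-- the same as working with ℝ).  The multiplicative inverse is a total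
-- function, specified only on nonzero arguments.

record RealNumbers : Set₁ where
  infixl 6 _+_
  infixl 7 _*_
  infix  4 _<_ _≤_
  field
    Carrier : Set
    0# 1#   : Carrier
    _+_ _*_ : Carrier → Carrier → Carrier
    -_      : Carrier → Carrier
    _⁻¹     : Carrier → Carrier
    _<_     : Rel Carrier 0ℓ
    isCommutativeRing  : IsCommutativeRing _≡_ _+_ _*_ -_ 0# 1#
    0≢1                : 0# ≢ 1#
    ⁻¹-inverse         : ∀ x → x ≢ 0# → x * (x ⁻¹) ≡ 1#
    isStrictTotalOrder : IsStrictTotalOrder _≡_ _<_
    +-mono-<           : ∀ {x y} z → x < y → x + z < y + z
    *-pos              : ∀ {x y} → 0# < x → 0# < y → 0# < x * y

  _≤_ : Rel Carrier 0ℓ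
  x ≤ y = x < y ⊎ x ≡ y

  field
    completeness : (S : Carrier → Set) → (∃ λ x → S x) →
                   (∃ λ b → ∀ x → S x → x ≤ b) →
                   ∃ λ s → (∀ x → S x → x ≤ s) ×
                           (∀ b → (∀ x → S x → x ≤ b) → s ≤ b)

-- Geometry of a polytope P = conv{u_0,…,u_{n-1}} ⊂ ℝ^d with the u_i its
-- vertices, and the objects of the paper.

module Geometry (ℝ : RealNumbers) where
  open RealNumbers ℝ

  Pt : ℕ → Set
  Pt d = Fin d → Carrier

  ∑ : ∀ {d} → (Fin d → Carrier) → Carrier
  ∑ {zero}  f = 0#
  ∑ {suc d} f = f zero + ∑ (λ i → f (suc i))

  ⟨_,_⟩ : ∀ {d} → Pt d → Pt d → Carrier
  ⟨ x , y ⟩ = ∑ (λ t → x t * y t)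

  _-ᵥ_ : ∀ {d} → Pt d → Pt d → Pt d
  (x -ᵥ y) t = x t + - (y t)

  module _ {d n : ℕ} (u : Fin n → Pt d) where

    IsVertex : Fin n → Set
    IsVertex i = ∃ λ (ω : Pt d) → ∀ k → k ≢ i → ⟨ ω , u k ⟩ < ⟨ ω , u i ⟩

    IsEdge : Fin n → Fin n → Set
    IsEdge i j = i ≢ j × (∃ λ (ω : Pt d) → ⟨ ω , u i ⟩ ≡ ⟨ ω , u j ⟩ ×
                   (∀ k → k ≢ i → k ≢ j → ⟨ ω , u k ⟩ < ⟨ ω , u i ⟩))

    CompleteGraph : Set
    CompleteGraph = ∀ i j → i ≢ j → IsEdge i j

    GenericLP : Pt d → Set
    GenericLP c = ∀ i j → IsEdge i j → ⟨ c , u i ⟩ ≢ ⟨ c , u j ⟩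

    LabelledBy : Pt d → Set
    LabelledBy c = ∀ i j → i <ᶠ j → ⟨ c , u i ⟩ < ⟨ c , u j ⟩

    Improving : Pt d → Fin n → Fin n → Set
    Improving c i j = IsEdge i j × ⟨ c , u i ⟩ < ⟨ c , u j ⟩

    ρ : Pt d → Pt d → Fin n → Fin n → Carrier
    ρ c ω i j = ⟨ ω , u j -ᵥ u i ⟩ * (⟨ c , u j -ᵥ u i ⟩ ⁻¹)

  FullDim : ∀ {d m} → (Fin (suc m) → Pt d) → Set
  FullDim {d} {m} u = ∀ (x : Pt d) → ∃ λ (λs : Fin (suc m) → Carrier) →
    ∀ t → x t ≡ ∑ (λ k → λs k * (u k -ᵥ u zero) t)

  LinIndep : ∀ {d} → Pt d → Pt d → Set
  LinIndep ω c = ∀ a b → (∀ t → a * ω t + b * c t ≡ 0#) → (a ≡ 0# × b ≡ 0#)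

  module _ {d m : ℕ} (u : Fin (suc m) → Pt d) (c : Pt d) where

    top : Fin (suc m)
    top = fromℕ m

    Generic : Pt d → Set
    Generic ω = LinIndep ω c × (∀ i → i ≢ top → ∃ λ j → Improving u c i j ×
                  (∀ k → Improving u c i k → k ≢ j → ρ u c ω i k < ρ u c ω i j))

    IsArgmaxMap : Pt d → (Fin (suc m) → Fin (suc m)) → Set
    IsArgmaxMap ω A = A top ≡ top × (∀ i → i ≢ top → Improving u c i (A i) ×
                  (∀ k → Improving u c i k → k ≢ A i → ρ u c ω i k < ρ u c ω i (A i)))

    τ : Pt d → (Fin (suc m) → Fin (suc m)) → Fin m → Carrier
    τ ω A i = ρ u c ω (inject₁ i) (A (inject₁ i))

    IsPi : Pt d → (Fin (suc m) → Fin (suc m)) → List (Fin m) → Set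
    IsPi ω A p = (p ↭ allFin m) × Linked (λ i j → τ ω A i < τ ω A j) p

data SylvStep {m : ℕ} : Rel (List (Fin m)) 0ℓ where
  rewr : ∀ (U V W : List (Fin m)) (i j k : Fin m) → i <ᶠ j → j <ᶠ k →
         SylvStep (U ++ j ∷ V ++ i ∷ k ∷ W) (U ++ j ∷ V ++ k ∷ i ∷ W)

_≡sylv_ : ∀ {m} → Rel (List (Fin m)) 0ℓ
_≡sylv_ = EqClosure SylvStep

-- Read 𝒜^ω on the non-top vertices as a code g, g i = 𝒜^ω(u_i). Since the graph is
-- complete and labelled by objective value, the slope ρ^ω(u_i, u_l) is the mediant
-- of the slopes through any u_k with i < k < l. Comparing with the maximality of
-- 𝒜^ω this gives τ(i) < τ(k) for i < k < g i, and τ(g i) < τ(i); so π^ω lists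
-- i before every such k and after g i ("compatibility"). Compatibility survives
-- sylvester moves and determines g. Conversely two permutations compatible with
-- the same g are congruent: bring the first letter a of one to the front of the
-- other by adjacent transpositions, each justified by a letter placed earlier,
-- strictly between a and the letter it passes (found from the code).

module Submission where

open import Defs
open import Level using (0ℓ)
open import Function.Base using (_∘_)
open import Function.Bundles using (_⇔_; mk⇔)
open import Data.Empty using (⊥-elim)
open import Data.Nat as ℕ using (ℕ; zero; suc)
import Data.Nat.Properties as ℕ
open import Data.Fin using (Fin; zero; suc; toℕ; inject₁; fromℕ; fromℕ<; _≟_)
open import Data.Fin.Properties using (toℕ-injective; toℕ-fromℕ<; toℕ-inject₁; toℕ<n; fromℕ≢inject₁)
open import Data.List using (List; []; _∷_; _++_; [_]; allFin)
open import Data.List.Properties using (++-assoc; ++-identityʳ)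
import Data.List.Relation.Unary.All as All
open import Data.List.Relation.Unary.AllPairs using (AllPairs; []; _∷_)
open import Data.List.Relation.Unary.Any using (here; there)
open import Data.List.Relation.Unary.Linked.Properties using (Linked⇒AllPairs)
open import Data.List.Relation.Unary.Unique.Propositional using (Unique)
open import Data.List.Relation.Unary.Unique.Propositional.Properties using (allFin⁺)
open import Data.List.Membership.Propositional using (_∈_; _∉_)
open import Data.List.Membership.Propositional.Properties using (∈-++⁺ˡ; ∈-++⁺ʳ; ∈-++⁻; ∈-∃++; ∈-allFin)
open import Data.List.Relation.Binary.Permutation.Propositional
  using (_↭_; ↭-refl; ↭-sym; ↭-trans; ↭-swap; ↭-prep; ↭⇒↭ₛ)
open import Data.List.Relation.Binary.Permutation.Propositional.Properties using (∈-resp-↭; ++⁺ˡ)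
import Data.List.Relation.Binary.Permutation.Setoid.Properties as Perm
open import Data.Product using (∃; _×_; _,_; proj₁; proj₂)
open import Data.Sum using (_⊎_; inj₁; inj₂)
open import Relation.Nullary using (¬_; yes; no)
open import Relation.Binary using (Tri; tri<; tri≈; tri>)
open import Relation.Binary.Structures using (IsStrictTotalOrder)
open import Relation.Binary.PropositionalEquality
  using (_≡_; _≢_; refl; sym; trans; cong; cong₂; subst; subst₂; setoid; module ≡-Reasoning)
open import Relation.Binary.Construct.Closure.ReflexiveTransitive using (ε; _◅_; _◅◅_)
open import Relation.Binary.Construct.Closure.Symmetric using (fwd; bwd)
open import Relation.Binary.Construct.Closure.Equivalence using (symmetric)
open import Algebra.Bundles using (CommutativeRing)

-- Order of occurrence in a word

module _ {A : Set} where

  data Precedes : List A → A → A → Set where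
    here  : ∀ {x y w} → y ∈ w → Precedes (x ∷ w) x y
    there : ∀ {x y z w} → Precedes w x y → Precedes (z ∷ w) x y

  precedes⇒∈ʳ : ∀ {w x y} → Precedes w x y → y ∈ w
  precedes⇒∈ʳ (here y∈w) = there y∈w
  precedes⇒∈ʳ (there p)  = there (precedes⇒∈ʳ p)

  precedes-++⁺ʳ : ∀ (U : List A) {w x y} → Precedes w x y → Precedes (U ++ w) x y
  precedes-++⁺ʳ []      p = p
  precedes-++⁺ʳ (_ ∷ U) p = there (precedes-++⁺ʳ U p)

  precedes-++⁺ : ∀ (U : List A) {W x y} → x ∈ U → y ∈ W → Precedes (U ++ W) x y
  precedes-++⁺ (_ ∷ U) (here refl) y∈W = here (∈-++⁺ʳ U y∈W)
  precedes-++⁺ (_ ∷ U) (there x∈U) y∈W = there (precedes-++⁺ U x∈U y∈W)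

  precedes-asym : ∀ {w x y} → Unique w → Precedes w x y → ¬ Precedes w y x
  precedes-asym (z∉w ∷ _) (here y∈w) (here _)   = All.lookup z∉w y∈w refl
  precedes-asym (z∉w ∷ _) (here _)   (there q)  = All.lookup z∉w (precedes⇒∈ʳ q) refl
  precedes-asym (z∉w ∷ _) (there p)  (here _)   = All.lookup z∉w (precedes⇒∈ʳ p) refl
  precedes-asym (_ ∷ !w)  (there p)  (there q)  = precedes-asym !w p q

  precedes-total : ∀ {w x y} → x ∈ w → y ∈ w → x ≢ y → Precedes w x y ⊎ Precedes w y x
  precedes-total (here refl) (here refl) x≢y = ⊥-elim (x≢y refl)
  precedes-total (here refl) (there y∈w) _   = inj₁ (here y∈w)
  precedes-total (there x∈w) (here refl) _   = inj₂ (here x∈w)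
  precedes-total (there x∈w) (there y∈w) x≢y with precedes-total x∈w y∈w x≢y
  ... | inj₁ p = inj₁ (there p)
  ... | inj₂ p = inj₂ (there p)

  precedes⇒AllPairs : ∀ {R : A → A → Set} {w x y} → AllPairs R w → Precedes w x y → R x y
  precedes⇒AllPairs (Rx ∷ _) (here y∈w) = All.lookup Rx y∈w
  precedes⇒AllPairs (_ ∷ Rw) (there p)  = precedes⇒AllPairs Rw p

  AllPairs⇒precedes : ∀ {R : A → A → Set} → (∀ {a b} → R a b → ¬ R b a) →
                      ∀ {w x y} → AllPairs R w → x ∈ w → y ∈ w → R x y → Precedes w x y
  AllPairs⇒precedes asym {w} {x} {y} Rw x∈w y∈w Rxy = orient (precedes-total x∈w y∈w x≢y)
    where
    x≢y : x ≢ y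
    x≢y refl = asym Rxy Rxy
    orient : Precedes w x y ⊎ Precedes w y x → Precedes w x y
    orient (inj₁ x-before-y) = x-before-y
    orient (inj₂ y-before-x) = ⊥-elim (asym Rxy (precedes⇒AllPairs Rw y-before-x))

  Unique-++⇒disjoint : ∀ (U : List A) {W x} → Unique (U ++ W) → x ∈ U → x ∉ W
  Unique-++⇒disjoint (_ ∷ U) (x∉ ∷ _)  (here refl) x∈W = All.lookup x∉ (∈-++⁺ʳ U x∈W) refl
  Unique-++⇒disjoint (_ ∷ U) (_ ∷ !UW) (there x∈U) x∈W = Unique-++⇒disjoint U !UW x∈U x∈W

  precedes⇒∈-prefix : ∀ (U : List A) {a W x} → Unique (U ++ a ∷ W) → Precedes (U ++ a ∷ W) x a → x ∈ U
  precedes⇒∈-prefix []      (a∉W ∷ _) (here a∈W) = ⊥-elim (All.lookup a∉W a∈W refl)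
  precedes⇒∈-prefix []      (a∉W ∷ _) (there p)  = ⊥-elim (All.lookup a∉W (precedes⇒∈ʳ p) refl)
  precedes⇒∈-prefix (_ ∷ U) _         (here _)   = here refl
  precedes⇒∈-prefix (_ ∷ U) (_ ∷ !w)  (there p)  = there (precedes⇒∈-prefix U !w p)

  ↭-swap-adjacent : ∀ (U : List A) {a b W} → U ++ a ∷ b ∷ W ↭ U ++ b ∷ a ∷ W
  ↭-swap-adjacent U {a} {b} = ++⁺ˡ U (↭-swap a b ↭-refl)

  precedes-swap : ∀ (U : List A) {a b W x y} → Precedes (U ++ a ∷ b ∷ W) x y → ¬ (x ≡ a × y ≡ b) →
                  Precedes (U ++ b ∷ a ∷ W) x y
  precedes-swap []      (here (here refl))   ¬ab = ⊥-elim (¬ab (refl , refl))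
  precedes-swap []      (here (there y∈W))   _   = there (here y∈W)
  precedes-swap []      (there (here y∈W))   _   = here (there y∈W)
  precedes-swap []      (there (there p))    _   = there (there p)
  precedes-swap (_ ∷ U) (here y∈w)           _   = here (∈-resp-↭ (↭-swap-adjacent U) y∈w)
  precedes-swap (_ ∷ U) (there p)            ¬ab = there (precedes-swap U p ¬ab)

-- Words compatible with a code, and the sylvester congruence

module _ {m : ℕ} where

  -- A code g is the argmax map 𝒜 on [m] read through toℕ; the value g i = m is
  -- the top vertex u_n, which is not a letter.
  record CompatibleAt (g : Fin m → ℕ) (w : List (Fin m)) (i : Fin m) : Set where
    field
      below-code    : toℕ i ℕ.< g i
      between-after : ∀ k → toℕ i ℕ.< toℕ k → toℕ k ℕ.< g i → Precedes w i k
      code-before   : ∀ k → toℕ k ≡ g i → Precedes w k i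

  open CompatibleAt

  Compatible : (Fin m → ℕ) → List (Fin m) → Set
  Compatible g w = ∀ i → CompatibleAt g w i

  record CompatiblePermutation (g : Fin m → ℕ) (w : List (Fin m)) : Set where
    field
      permutation : w ↭ allFin m
      compatible  : Compatible g w

    unique : Unique w
    unique = Perm.Unique-resp-↭ (setoid (Fin m)) (↭⇒↭ₛ (↭-sym permutation)) (allFin⁺ m)

    contains : ∀ x → x ∈ w
    contains x = ∈-resp-↭ (↭-sym permutation) (∈-allFin x)

  open CompatiblePermutation

  compatible-resp-≗ : ∀ {g h w} → (∀ i → g i ≡ h i) → Compatible g w → Compatible h w
  compatible-resp-≗ g≗h cw i = record
    { below-code    = subst (toℕ i ℕ.<_) (g≗h i) (below-code (cw i))
    ; between-after = λ k i<k k<hi → between-after (cw i) k i<k (subst (toℕ k ℕ.<_) (sym (g≗h i)) k<hi)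
    ; code-before   = λ k k≡hi → code-before (cw i) k (trans k≡hi (sym (g≗h i)))
    }

  -- the two ways in which compatibility with g can force a to precede b
  Forces : (Fin m → ℕ) → Fin m → Fin m → Set
  Forces g a b = (toℕ a ℕ.< toℕ b × toℕ b ℕ.< g a) ⊎ (toℕ a ≡ g b)

  compatible-swap : ∀ {g} U {a b W} → ¬ Forces g a b →
                    Compatible g (U ++ a ∷ b ∷ W) → Compatible g (U ++ b ∷ a ∷ W)
  compatible-swap U ¬forces cw i = record
    { below-code    = below-code (cw i)
    ; between-after = λ k i<k k<gi → precedes-swap U (between-after (cw i) k i<k k<gi)
                                       λ { (refl , refl) → ¬forces (inj₁ (i<k , k<gi)) }
    ; code-before   = λ k k≡gi → precedes-swap U (code-before (cw i) k k≡gi)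
                                   λ { (refl , refl) → ¬forces (inj₂ k≡gi) }
    }

  module _ {g : Fin m → ℕ} {U W : List (Fin m)} {i j k : Fin m} (j∈U : j ∈ U)
           (i<j : toℕ i ℕ.< toℕ j) (j<k : toℕ j ℕ.< toℕ k) where

    compatible-sylvRewrite : Unique (U ++ i ∷ k ∷ W) →
                             Compatible g (U ++ i ∷ k ∷ W) → Compatible g (U ++ k ∷ i ∷ W)
    compatible-sylvRewrite !w cw = compatible-swap U ¬forces cw
      where
      ¬forces : ¬ Forces g i k
      ¬forces (inj₁ (_ , k<gi)) = precedes-asym !w (precedes-++⁺ U j∈U (here refl))
                                    (between-after (cw i) j i<j (ℕ.<-trans j<k k<gi))
      ¬forces (inj₂ i≡gk)       = ℕ.<-asym (ℕ.<-trans i<j j<k)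
                                    (subst (toℕ k ℕ.<_) (sym i≡gk) (below-code (cw k)))

    compatible-sylvRewrite⁻¹ : Unique (U ++ k ∷ i ∷ W) →
                               Compatible g (U ++ k ∷ i ∷ W) → Compatible g (U ++ i ∷ k ∷ W)
    compatible-sylvRewrite⁻¹ !w cw = compatible-swap U ¬forces cw
      where
      ¬forces : ¬ Forces g k i
      ¬forces (inj₁ (k<i , _)) = ℕ.<-asym (ℕ.<-trans i<j j<k) k<i
      ¬forces (inj₂ k≡gi)      = precedes-asym !w (precedes-++⁺ U j∈U (there (here refl)))
                                   (between-after (cw i) j i<j (subst (toℕ j ℕ.<_) k≡gi j<k))

  sylvStep⇒↭ : ∀ {w w'} → SylvStep {m} w w' → w ↭ w'
  sylvStep⇒↭ (rewr U V W i j k _ _) = ++⁺ˡ U (↭-prep j (++⁺ˡ V (↭-swap i k ↭-refl)))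

  module _ {g : Fin m → ℕ} where

    private
      reassociate : ∀ U V {j} (X : List (Fin m)) → U ++ j ∷ V ++ X ≡ (U ++ j ∷ V) ++ X
      reassociate U V {j} X = sym (++-assoc U (j ∷ V) X)

      j∈ : ∀ U V {j : Fin m} → j ∈ U ++ j ∷ V
      j∈ U V = ∈-++⁺ʳ U (here refl)

    compatiblePermutation-sylvStep : ∀ {w w'} → SylvStep w w' →
                                     CompatiblePermutation g w → CompatiblePermutation g w'
    compatiblePermutation-sylvStep s@(rewr U V W i j k i<j j<k) cp = record
      { permutation = ↭-trans (↭-sym (sylvStep⇒↭ s)) (permutation cp)
      ; compatible  = subst (Compatible g) (sym (reassociate U V (k ∷ i ∷ W)))
          (compatible-sylvRewrite (j∈ U V) i<j j<k
            (subst Unique (reassociate U V (i ∷ k ∷ W)) (unique cp))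
            (subst (Compatible g) (reassociate U V (i ∷ k ∷ W)) (compatible cp)))
      }

    compatiblePermutation-sylvStep⁻¹ : ∀ {w w'} → SylvStep w w' →
                                       CompatiblePermutation g w' → CompatiblePermutation g w
    compatiblePermutation-sylvStep⁻¹ s@(rewr U V W i j k i<j j<k) cp = record
      { permutation = ↭-trans (sylvStep⇒↭ s) (permutation cp)
      ; compatible  = subst (Compatible g) (sym (reassociate U V (i ∷ k ∷ W)))
          (compatible-sylvRewrite⁻¹ (j∈ U V) i<j j<k
            (subst Unique (reassociate U V (k ∷ i ∷ W)) (unique cp))
            (subst (Compatible g) (reassociate U V (k ∷ i ∷ W)) (compatible cp)))
      }

    compatiblePermutation-≡sylv : ∀ {w w'} → w ≡sylv w' →
                                  CompatiblePermutation g w → CompatiblePermutation g w'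
    compatiblePermutation-≡sylv ε            cp = cp
    compatiblePermutation-≡sylv (fwd s ◅ ss) cp =
      compatiblePermutation-≡sylv ss (compatiblePermutation-sylvStep s cp)
    compatiblePermutation-≡sylv (bwd s ◅ ss) cp =
      compatiblePermutation-≡sylv ss (compatiblePermutation-sylvStep⁻¹ s cp)

  -- If g i < h i, the letter g i would have to precede i (for g) and follow it (for h).
  compatible-code-≥ : ∀ {g h w} → Unique w → Compatible g w → Compatible h w →
                      ∀ i → h i ℕ.≤ m → ¬ g i ℕ.< h i
  compatible-code-≥ {g} {h} !w cg ch i hi≤m gi<hi =
    precedes-asym !w (code-before (cg i) k (toℕ-fromℕ< gi<m))
      (between-after (ch i) k (subst (toℕ i ℕ.<_) (sym (toℕ-fromℕ< gi<m)) (below-code (cg i)))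
                              (subst (ℕ._< h i) (sym (toℕ-fromℕ< gi<m)) gi<hi))
    where
    gi<m : g i ℕ.< m
    gi<m = ℕ.<-≤-trans gi<hi hi≤m
    k : Fin m
    k = fromℕ< gi<m

  compatible-code-unique : ∀ {g h w} → Unique w → Compatible g w → Compatible h w →
                           (∀ i → g i ℕ.≤ m) → (∀ i → h i ℕ.≤ m) → ∀ i → g i ≡ h i
  compatible-code-unique !w cg ch g≤m h≤m i =
    ℕ.≤-antisym (ℕ.≮⇒≥ (compatible-code-≥ !w ch cg i (g≤m i)))
                (ℕ.≮⇒≥ (compatible-code-≥ !w cg ch i (h≤m i)))

  -- The separating letter is g x.
  code-separates : ∀ {g w w' x y} → Unique w → Unique w' → Compatible g w → Compatible g w' →
                   Precedes w x y → Precedes w' y x → toℕ x ℕ.< toℕ y →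
                   ∃ λ s → Precedes w s x × toℕ x ℕ.< toℕ s × toℕ s ℕ.< toℕ y
  code-separates {g} {w} {w'} {x} {y} !w !w' cw cw' xy yx x<y =
    s , s-before-x , subst (toℕ x ℕ.<_) (sym s≡gx) (below-code (cw x)) , s<y
    where
    gx≤y : g x ℕ.≤ toℕ y
    gx≤y = ℕ.≮⇒≥ λ y<gx → precedes-asym !w' (between-after (cw' x) y x<y y<gx) yx
    gx<m : g x ℕ.< m
    gx<m = ℕ.≤-<-trans gx≤y (toℕ<n y)
    s : Fin m
    s = fromℕ< gx<m
    s≡gx : toℕ s ≡ g x
    s≡gx = toℕ-fromℕ< gx<m
    s-before-x : Precedes w s x
    s-before-x = code-before (cw x) s s≡gx
    s<y : toℕ s ℕ.< toℕ y
    s<y = ℕ.≤∧≢⇒< (subst (ℕ._≤ toℕ y) (sym s≡gx) gx≤y)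
            λ s≡y → precedes-asym !w xy (subst (λ t → Precedes w t x) (toℕ-injective s≡y) s-before-x)

  Between : Fin m → Fin m → Fin m → Set
  Between x y j = (toℕ x ℕ.< toℕ j × toℕ j ℕ.< toℕ y) ⊎ (toℕ y ℕ.< toℕ j × toℕ j ℕ.< toℕ x)

  ≡sylv-swap-adjacent : ∀ U {x y W j} → j ∈ U → Between x y j →
                        (U ++ x ∷ y ∷ W) ≡sylv (U ++ y ∷ x ∷ W)
  ≡sylv-swap-adjacent U {x} {y} {W} {j} j∈U between with ∈-∃++ j∈U
  ... | U₁ , V , refl =
    subst₂ _≡sylv_ (sym (++-assoc U₁ (j ∷ V) (x ∷ y ∷ W))) (sym (++-assoc U₁ (j ∷ V) (y ∷ x ∷ W)))
      (swap between)
    where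
    swap : Between x y j → (U₁ ++ j ∷ V ++ x ∷ y ∷ W) ≡sylv (U₁ ++ j ∷ V ++ y ∷ x ∷ W)
    swap (inj₁ (x<j , j<y)) = fwd (rewr U₁ V W x j y x<j j<y) ◅ ε
    swap (inj₂ (y<j , j<x)) = bwd (rewr U₁ V W y j x y<j j<x) ◅ ε

  ≡sylv-bubble : ∀ U Z a W →
                 (∀ Z₁ z Z₂ → Z ≡ Z₁ ++ z ∷ Z₂ → ∃ λ j → j ∈ U ++ Z₁ × Between z a j) →
                 (U ++ Z ++ a ∷ W) ≡sylv (U ++ a ∷ Z ++ W)
  ≡sylv-bubble U []      a W _ = ε
  ≡sylv-bubble U (z ∷ Z) a W separated with separated [] z Z refl
  ... | j , j∈U , between =
    subst₂ _≡sylv_ (++-assoc U [ z ] (Z ++ a ∷ W)) (++-assoc U [ z ] (a ∷ Z ++ W)) bubble-Z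
      ◅◅ ≡sylv-swap-adjacent U (subst (j ∈_) (++-identityʳ U) j∈U) between
    where
    bubble-Z : ((U ++ [ z ]) ++ Z ++ a ∷ W) ≡sylv ((U ++ [ z ]) ++ a ∷ Z ++ W)
    bubble-Z = ≡sylv-bubble (U ++ [ z ]) Z a W λ Z₁ z′ Z₂ eq →
      let j′ , j′∈ , b = separated (z ∷ Z₁) z′ Z₂ (cong (z ∷_) eq)
      in j′ , subst (j′ ∈_) (sym (++-assoc U [ z ] Z₁)) j′∈ , b

  bubble-separated : ∀ {g} U a p Z₁ z Z₂ R →
                     CompatiblePermutation g (U ++ a ∷ p) →
                     CompatiblePermutation g (U ++ (Z₁ ++ z ∷ Z₂) ++ a ∷ R) →
                     ∃ λ j → j ∈ U ++ Z₁ × Between z a j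
  bubble-separated {g} U a p Z₁ z Z₂ R cp cq = separate (ℕ.<-cmp (toℕ z) (toℕ a))
    where
    P Q : List (Fin m)
    P = U ++ a ∷ p
    Q = (U ++ Z₁) ++ z ∷ Z₂ ++ a ∷ R
    cq' : CompatiblePermutation g Q
    cq' = subst (CompatiblePermutation g)
            (trans (cong (U ++_) (++-assoc Z₁ (z ∷ Z₂) (a ∷ R))) (sym (++-assoc U Z₁ _))) cq
    z-before-a : Precedes Q z a
    z-before-a = precedes-++⁺ʳ (U ++ Z₁) (here (∈-++⁺ʳ Z₂ (here refl)))
    z≢a : z ≢ a
    z≢a refl = precedes-asym (unique cq') z-before-a z-before-a
    z∈p : z ∈ p
    z∈p with ∈-++⁻ U (contains cp z)
    ... | inj₁ z∈U         = ⊥-elim (Unique-++⇒disjoint U (unique cq) z∈U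
                                       (∈-++⁺ˡ (∈-++⁺ʳ Z₁ (here refl))))
    ... | inj₂ (here z≡a)  = ⊥-elim (z≢a z≡a)
    ... | inj₂ (there z∈p) = z∈p
    a-before-z : Precedes P a z
    a-before-z = precedes-++⁺ʳ U (here z∈p)
    separate : Tri (toℕ z ℕ.< toℕ a) (toℕ z ≡ toℕ a) (toℕ a ℕ.< toℕ z) →
               ∃ λ j → j ∈ U ++ Z₁ × Between z a j
    separate (tri< z<a _ _) =
      let s , s-before-z , z<s , s<a = code-separates (unique cq') (unique cp)
                                         (compatible cq') (compatible cp) z-before-a a-before-z z<a
      in s , precedes⇒∈-prefix (U ++ Z₁) (unique cq') s-before-z , inj₁ (z<s , s<a)
    separate (tri≈ _ z≡a _) = ⊥-elim (z≢a (toℕ-injective z≡a))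
    separate (tri> _ _ a<z) =
      let s , s-before-a , a<s , s<z = code-separates (unique cp) (unique cq')
                                         (compatible cp) (compatible cq') a-before-z z-before-a a<z
      in s , ∈-++⁺ˡ (precedes⇒∈-prefix U (unique cp) s-before-a) , inj₂ (a<s , s<z)

  compatiblePermutations-≡sylv : ∀ {g} U p q → CompatiblePermutation g (U ++ p) →
                                 CompatiblePermutation g (U ++ q) → (U ++ p) ≡sylv (U ++ q)
  compatiblePermutations-≡sylv U []      []      _  _  = ε
  compatiblePermutations-≡sylv U []      (z ∷ q) cp cq = ⊥-elim
    (Unique-++⇒disjoint U (unique cq) (subst (z ∈_) (++-identityʳ U) (contains cp z)) (here refl))
  compatiblePermutations-≡sylv {g} U (a ∷ p) q cp cq with ∈-++⁻ U (contains cq a)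
  ... | inj₁ a∈U = ⊥-elim (Unique-++⇒disjoint U (unique cp) a∈U (here refl))
  ... | inj₂ a∈q with ∈-∃++ a∈q
  ... | Z , R , refl = a-first ◅◅ symmetric SylvStep bubble
    where
    bubble : (U ++ Z ++ a ∷ R) ≡sylv (U ++ a ∷ Z ++ R)
    bubble = ≡sylv-bubble U Z a R λ { Z₁ z Z₂ refl → bubble-separated U a p Z₁ z Z₂ R cp cq }
    shift : ∀ X → CompatiblePermutation g (U ++ a ∷ X) → CompatiblePermutation g ((U ++ [ a ]) ++ X)
    shift X = subst (CompatiblePermutation g) (sym (++-assoc U [ a ] X))
    a-first : (U ++ a ∷ p) ≡sylv (U ++ a ∷ Z ++ R)
    a-first = subst₂ _≡sylv_ (++-assoc U [ a ] p) (++-assoc U [ a ] (Z ++ R))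
      (compatiblePermutations-≡sylv (U ++ [ a ]) p (Z ++ R)
        (shift p cp) (shift (Z ++ R) (compatiblePermutation-≡sylv bubble cq)))

-- Ordered fields

module OrderedField (ℝ : RealNumbers) where
  open RealNumbers ℝ
  open IsStrictTotalOrder isStrictTotalOrder using (irrefl; asym; compare) renaming (trans to <-trans)

  commutativeRing : CommutativeRing 0ℓ 0ℓ
  commutativeRing = record { isCommutativeRing = isCommutativeRing }

  open CommutativeRing commutativeRing
    using (+-comm; *-assoc; *-comm; distribˡ; +-identityˡ; *-identityʳ; *-identityˡ;
           -‿inverseʳ; zeroʳ; ring)
  open import Algebra.Properties.Ring ring
    using (-‿distribˡ-*; -‿distribʳ-*; -‿involutive; //-rightDividesˡ; \\-leftDividesʳ; [y-z]x≈yx-zx)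
  open ≡-Reasoning

  +-monoʳ-< : ∀ {x y} z → x < y → z + x < z + y
  +-monoʳ-< {x} {y} z x<y = subst₂ _<_ (+-comm x z) (+-comm y z) (+-mono-< z x<y)

  x<y⇒0<y-x : ∀ {x y} → x < y → 0# < y + - x
  x<y⇒0<y-x {x} {y} x<y = subst (_< y + - x) (-‿inverseʳ x) (+-mono-< (- x) x<y)

  0<y-x⇒x<y : ∀ {x y} → 0# < y + - x → x < y
  0<y-x⇒x<y {x} {y} 0<y-x = subst₂ _<_ (+-identityˡ x) (//-rightDividesˡ x y) (+-mono-< x 0<y-x)

  *-monoˡ-<-pos : ∀ {x y z} → 0# < z → x < y → x * z < y * z
  *-monoˡ-<-pos {x} {y} {z} 0<z x<y =
    0<y-x⇒x<y (subst (0# <_) ([y-z]x≈yx-zx z y x) (*-pos (x<y⇒0<y-x x<y) 0<z))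

  <-≤-trans : ∀ {x y z} → x < y → y ≤ z → x < z
  <-≤-trans x<y (inj₁ y<z)  = <-trans x<y y<z
  <-≤-trans x<y (inj₂ refl) = x<y

  0<x⇒x≢0 : ∀ {x} → 0# < x → x ≢ 0#
  0<x⇒x≢0 0<x x≡0 = irrefl (sym x≡0) 0<x

  0<1 : 0# < 1#
  0<1 with compare 0# 1#
  ... | tri< 0<1 _ _ = 0<1
  ... | tri≈ _ 0≡1 _ = ⊥-elim (0≢1 0≡1)
  ... | tri> _ _ 1<0 = ⊥-elim (asym 1<0 (subst (0# <_) -1*-1≡1 (*-pos 0<-1 0<-1)))
    where
    0<-1 : 0# < - 1#
    0<-1 = subst (0# <_) (+-identityˡ (- 1#)) (x<y⇒0<y-x 1<0)
    -1*-1≡1 : - 1# * - 1# ≡ 1#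
    -1*-1≡1 = begin
      - 1# * - 1#    ≡⟨ -‿distribˡ-* 1# (- 1#) ⟨
      - (1# * - 1#)  ≡⟨ cong -_ (*-identityˡ (- 1#)) ⟩
      - - 1#         ≡⟨ -‿involutive 1# ⟩
      1#             ∎

  0<x⇒0<x⁻¹ : ∀ {x} → 0# < x → 0# < x ⁻¹
  0<x⇒0<x⁻¹ {x} 0<x with compare 0# (x ⁻¹)
  ... | tri< 0<x⁻¹ _ _ = 0<x⁻¹
  ... | tri≈ _ 0≡x⁻¹ _ = ⊥-elim (0≢1 (begin
      0#        ≡⟨ zeroʳ x ⟨
      x * 0#    ≡⟨ cong (x *_) 0≡x⁻¹ ⟩
      x * x ⁻¹  ≡⟨ ⁻¹-inverse x (0<x⇒x≢0 0<x) ⟩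
      1#        ∎))
  ... | tri> _ _ x⁻¹<0 = ⊥-elim (asym 0<1 (0<y-x⇒x<y (subst (0# <_) x*-x⁻¹≡0-1 (*-pos 0<x 0<-x⁻¹))))
    where
    0<-x⁻¹ : 0# < - (x ⁻¹)
    0<-x⁻¹ = subst (0# <_) (+-identityˡ _) (x<y⇒0<y-x x⁻¹<0)
    x*-x⁻¹≡0-1 : x * - (x ⁻¹) ≡ 0# + - 1#
    x*-x⁻¹≡0-1 = begin
      x * - (x ⁻¹)   ≡⟨ -‿distribʳ-* x (x ⁻¹) ⟨
      - (x * x ⁻¹)   ≡⟨ cong -_ (⁻¹-inverse x (0<x⇒x≢0 0<x)) ⟩
      - 1#           ≡⟨ +-identityˡ (- 1#) ⟨
      0# + - 1#      ∎

  *-⁻¹-cancelʳ : ∀ {x} y → x ≢ 0# → y * x ⁻¹ * x ≡ y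
  *-⁻¹-cancelʳ {x} y x≢0 = begin
    y * x ⁻¹ * x    ≡⟨ *-assoc y (x ⁻¹) x ⟩
    y * (x ⁻¹ * x)  ≡⟨ cong (y *_) (*-comm (x ⁻¹) x) ⟩
    y * (x * x ⁻¹)  ≡⟨ cong (y *_) (⁻¹-inverse x x≢0) ⟩
    y * 1#          ≡⟨ *-identityʳ y ⟩
    y               ∎

  *-cancelʳ-⁻¹ : ∀ {x} y → x ≢ 0# → y * x * x ⁻¹ ≡ y
  *-cancelʳ-⁻¹ {x} y x≢0 = begin
    y * x * x ⁻¹    ≡⟨ *-assoc y x (x ⁻¹) ⟩
    y * (x * x ⁻¹)  ≡⟨ cong (y *_) (⁻¹-inverse x x≢0) ⟩
    y * 1#          ≡⟨ *-identityʳ y ⟩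
    y               ∎

  +-≡-cross-< : ∀ {x y z w} → x + y ≡ z + w → x < z → w < y
  +-≡-cross-< {x} {y} {z} {w} x+y≡z+w x<z =
    subst₂ _<_ (\\-leftDividesʳ z w) (\\-leftDividesʳ z y) (+-monoʳ-< (- z) z+w<z+y)
    where
    z+w<z+y : z + w < z + y
    z+w<z+y = subst (_< z + y) x+y≡z+w (+-mono-< y x<z)

  module _ {a b α β : Carrier} (0<a : 0# < a) (0<b : 0# < b) where

    private
      0<a+b : 0# < a + b
      0<a+b = <-trans 0<b (subst (_< a + b) (+-identityˡ b) (+-mono-< b 0<a))

      mediant-weights : α + β ≡ (α + β) * (a + b) ⁻¹ * a + (α + β) * (a + b) ⁻¹ * b
      mediant-weights = trans (sym (*-⁻¹-cancelʳ (α + β) (0<x⇒x≢0 0<a+b))) (distribˡ _ a b)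

    mediant-<ʳ : α * a ⁻¹ < (α + β) * (a + b) ⁻¹ → (α + β) * (a + b) ⁻¹ < β * b ⁻¹
    mediant-<ʳ α/a<s = subst (_< β * b ⁻¹) (*-cancelʳ-⁻¹ _ (0<x⇒x≢0 0<b))
                         (*-monoˡ-<-pos (0<x⇒0<x⁻¹ 0<b) (+-≡-cross-< mediant-weights α<sa))
      where
      α<sa : α < (α + β) * (a + b) ⁻¹ * a
      α<sa = subst (_< (α + β) * (a + b) ⁻¹ * a) (*-⁻¹-cancelʳ α (0<x⇒x≢0 0<a)) (*-monoˡ-<-pos 0<a α/a<s)

    mediant->ʳ : (α + β) * (a + b) ⁻¹ < α * a ⁻¹ → β * b ⁻¹ < (α + β) * (a + b) ⁻¹
    mediant->ʳ s<α/a = subst (β * b ⁻¹ <_) (*-cancelʳ-⁻¹ _ (0<x⇒x≢0 0<b))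
                         (*-monoˡ-<-pos (0<x⇒0<x⁻¹ 0<b) (+-≡-cross-< (sym mediant-weights) sa<α))
      where
      sa<α : (α + β) * (a + b) ⁻¹ * a < α
      sa<α = subst ((α + β) * (a + b) ⁻¹ * a <_) (*-⁻¹-cancelʳ α (0<x⇒x≢0 0<a)) (*-monoˡ-<-pos 0<a s<α/a)

argmaxCode : ∀ {m} → (Fin (suc m) → Fin (suc m)) → Fin m → ℕ
argmaxCode A i = toℕ (A (inject₁ i))

argmaxCode-≤ : ∀ {m} (A : Fin (suc m) → Fin (suc m)) i → argmaxCode A i ℕ.≤ m
argmaxCode-≤ A i = ℕ.≤-pred (toℕ<n (A (inject₁ i)))

-- Slopes of a linear program

module LinearProgram (ℝ : RealNumbers) where
  open RealNumbers ℝ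
  open Geometry ℝ
  open OrderedField ℝ
  open IsStrictTotalOrder isStrictTotalOrder using (irrefl; asym) renaming (trans to <-trans)
  open CommutativeRing commutativeRing using (+-comm; +-assoc; -‿inverseʳ; ring; +-commutativeSemigroup)
  open import Algebra.Properties.Ring ring using (x[y-z]≈xy-xz; -‿+-comm; \\-leftDividesʳ)
  open import Algebra.Properties.CommutativeSemigroup +-commutativeSemigroup using (interchange)
  open ≡-Reasoning

  ⟨⟩-distrib-ᵥ : ∀ {d} (ω x y : Pt d) → ⟨ ω , x -ᵥ y ⟩ ≡ ⟨ ω , x ⟩ + - ⟨ ω , y ⟩
  ⟨⟩-distrib-ᵥ {zero}  ω x y = sym (-‿inverseʳ 0#)
  ⟨⟩-distrib-ᵥ {suc d} ω x y = begin
    a * (b + - c) + ⟨ ω′ , x′ -ᵥ y′ ⟩  ≡⟨ cong₂ _+_ (x[y-z]≈xy-xz a b c) (⟨⟩-distrib-ᵥ ω′ x′ y′) ⟩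
    (a * b + - (a * c)) + (S + - T)    ≡⟨ interchange (a * b) (- (a * c)) S (- T) ⟩
    (a * b + S) + (- (a * c) + - T)    ≡⟨ cong ((a * b + S) +_) (-‿+-comm (a * c) T) ⟩
    (a * b + S) + - (a * c + T)        ∎
    where
    a b c S T : Carrier
    a = ω zero
    b = x zero
    c = y zero
    ω′ x′ y′ : Pt d
    ω′ = ω ∘ suc
    x′ = x ∘ suc
    y′ = y ∘ suc
    S = ⟨ ω′ , x′ ⟩
    T = ⟨ ω′ , y′ ⟩

  telescope : ∀ x y z → (y + - x) + (z + - y) ≡ z + - x
  telescope x y z = begin
    (y + - x) + (z + - y)    ≡⟨ +-comm (y + - x) (z + - y) ⟩
    (z + - y) + (y + - x)    ≡⟨ +-assoc z (- y) (y + - x) ⟩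
    z + (- y + (y + - x))    ≡⟨ cong (z +_) (\\-leftDividesʳ y (- x)) ⟩
    z + - x                  ∎

  module _ {d n : ℕ} (u : Fin n → Pt d) (c ω : Pt d) where

    private
      X Y : Fin n → Carrier
      X i = ⟨ c , u i ⟩
      Y i = ⟨ ω , u i ⟩

    ρ-difference-quotient : ∀ i j → ρ u c ω i j ≡ (Y j + - Y i) * (X j + - X i) ⁻¹
    ρ-difference-quotient i j =
      cong₂ (λ α a → α * a ⁻¹) (⟨⟩-distrib-ᵥ ω (u j) (u i)) (⟨⟩-distrib-ᵥ c (u j) (u i))

    ρ-mediant : ∀ i k l →
                ρ u c ω i l ≡ ((Y k + - Y i) + (Y l + - Y k)) * ((X k + - X i) + (X l + - X k)) ⁻¹
    ρ-mediant i k l = trans (ρ-difference-quotient i l)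
      (sym (cong₂ (λ α a → α * a ⁻¹) (telescope (Y i) (Y k) (Y l)) (telescope (X i) (X k) (X l))))

    module _ {i k l : Fin n} (Xi<Xk : X i < X k) (Xk<Xl : X k < X l) where

      ρ-mediant-<ʳ : ρ u c ω i k < ρ u c ω i l → ρ u c ω i l < ρ u c ω k l
      ρ-mediant-<ʳ ρik<ρil = subst₂ _<_ (sym (ρ-mediant i k l)) (sym (ρ-difference-quotient k l))
        (mediant-<ʳ (x<y⇒0<y-x Xi<Xk) (x<y⇒0<y-x Xk<Xl)
          (subst₂ _<_ (ρ-difference-quotient i k) (ρ-mediant i k l) ρik<ρil))

      ρ-mediant->ʳ : ρ u c ω i l < ρ u c ω i k → ρ u c ω k l < ρ u c ω i l
      ρ-mediant->ʳ ρil<ρik = subst₂ _<_ (sym (ρ-difference-quotient k l)) (sym (ρ-mediant i k l))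
        (mediant->ʳ (x<y⇒0<y-x Xi<Xk) (x<y⇒0<y-x Xk<Xl)
          (subst₂ _<_ (ρ-mediant i k l) (ρ-difference-quotient i k) ρil<ρik))

  module _ {d m : ℕ} (u : Fin (suc m) → Pt d) (c : Pt d)
           (complete : CompleteGraph u) (labelled : LabelledBy u c) where

    labelled⇒toℕ-< : ∀ {i j} → ⟨ c , u i ⟩ < ⟨ c , u j ⟩ → toℕ i ℕ.< toℕ j
    labelled⇒toℕ-< {i} {j} Xi<Xj with ℕ.<-cmp (toℕ i) (toℕ j)
    ... | tri< i<j _ _ = i<j
    ... | tri≈ _ i≡j _ = ⊥-elim (irrefl (cong (λ t → ⟨ c , u t ⟩) (toℕ-injective i≡j)) Xi<Xj)
    ... | tri> _ _ j<i = ⊥-elim (asym Xi<Xj (labelled j i j<i))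

    toℕ-<⇒improving : ∀ {i j} → toℕ i ℕ.< toℕ j → Improving u c i j
    toℕ-<⇒improving {i} {j} i<j = complete i j (λ { refl → ℕ.<-irrefl refl i<j }) , labelled i j i<j

    module _ {ω : Pt d} {A : Fin (suc m) → Fin (suc m)} (argmax : IsArgmaxMap u c ω A) where

      private
        ρ′ : Fin (suc m) → Fin (suc m) → Carrier
        ρ′ = ρ u c ω
        τ′ : Fin m → Carrier
        τ′ = τ u c ω A

        improving-argmax : ∀ i → Improving u c (inject₁ i) (A (inject₁ i))
        improving-argmax i = proj₁ (proj₂ argmax (inject₁ i) (fromℕ≢inject₁ ∘ sym))

        ρ-<-τ : ∀ i j → Improving u c (inject₁ i) j → j ≢ A (inject₁ i) → ρ′ (inject₁ i) j < τ′ i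
        ρ-<-τ i = proj₂ (proj₂ argmax (inject₁ i) (fromℕ≢inject₁ ∘ sym))

        ρ-≤-τ : ∀ i j → Improving u c (inject₁ i) j → ρ′ (inject₁ i) j ≤ τ′ i
        ρ-≤-τ i j improving with j ≟ A (inject₁ i)
        ... | yes refl = inj₂ refl
        ... | no  j≢Ai = inj₁ (ρ-<-τ i j improving j≢Ai)

      toℕ-<-argmax : ∀ i → toℕ (inject₁ i) ℕ.< toℕ (A (inject₁ i))
      toℕ-<-argmax i = labelled⇒toℕ-< (proj₂ (improving-argmax i))

      τ-<-between : ∀ i k → toℕ i ℕ.< toℕ k → toℕ k ℕ.< toℕ (A (inject₁ i)) → τ′ i < τ′ k
      τ-<-between i k i<k k<Ai = <-≤-trans ρiAi<ρkAi (ρ-≤-τ k Ai (toℕ-<⇒improving k′<Ai))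
        where
        i′ k′ Ai : Fin (suc m)
        i′ = inject₁ i
        k′ = inject₁ k
        Ai = A i′
        i′<k′ : toℕ i′ ℕ.< toℕ k′
        i′<k′ = subst₂ ℕ._<_ (sym (toℕ-inject₁ i)) (sym (toℕ-inject₁ k)) i<k
        k′<Ai : toℕ k′ ℕ.< toℕ Ai
        k′<Ai = subst (ℕ._< toℕ Ai) (sym (toℕ-inject₁ k)) k<Ai
        ρik<ρiAi : ρ′ i′ k′ < ρ′ i′ Ai
        ρik<ρiAi = ρ-<-τ i k′ (toℕ-<⇒improving i′<k′) λ k′≡Ai → ℕ.<-irrefl (cong toℕ k′≡Ai) k′<Ai
        ρiAi<ρkAi : ρ′ i′ Ai < ρ′ k′ Ai
        ρiAi<ρkAi = ρ-mediant-<ʳ u c ω (labelled i′ k′ i′<k′) (labelled k′ Ai k′<Ai) ρik<ρiAi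

      τ-<-argmax : ∀ i k → A (inject₁ i) ≡ inject₁ k → τ′ k < τ′ i
      τ-<-argmax i k Ai≡k′ = <-trans ρkAk<ρiAk (subst (λ t → ρ′ i′ Ak < ρ′ i′ t) (sym Ai≡k′) ρiAk<ρik)
        where
        i′ k′ Ak : Fin (suc m)
        i′ = inject₁ i
        k′ = inject₁ k
        Ak = A k′
        i′<k′ : toℕ i′ ℕ.< toℕ k′
        i′<k′ = subst (λ t → toℕ i′ ℕ.< toℕ t) Ai≡k′ (toℕ-<-argmax i)
        k′<Ak : toℕ k′ ℕ.< toℕ Ak
        k′<Ak = toℕ-<-argmax k
        ρiAk<ρik : ρ′ i′ Ak < ρ′ i′ k′
        ρiAk<ρik = subst (λ t → ρ′ i′ Ak < ρ′ i′ t) Ai≡k′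
          (ρ-<-τ i Ak (toℕ-<⇒improving (ℕ.<-trans i′<k′ k′<Ak))
            λ Ak≡Ai → ℕ.<-irrefl (cong toℕ (sym (trans Ak≡Ai Ai≡k′))) k′<Ak)
        ρkAk<ρiAk : ρ′ k′ Ak < ρ′ i′ Ak
        ρkAk<ρiAk = ρ-mediant->ʳ u c ω (labelled i′ k′ i′<k′) (labelled k′ Ak k′<Ak) ρiAk<ρik

      π-compatiblePermutation : ∀ {p} → IsPi u c ω A p → CompatiblePermutation (argmaxCode A) p
      π-compatiblePermutation {p} (p↭allFin , sorted) = record
        { permutation = p↭allFin
        ; compatible  = λ i → record
          { below-code    = subst (ℕ._< argmaxCode A i) (toℕ-inject₁ i) (toℕ-<-argmax i)
          ; between-after = λ k i<k k<Ai → τ-<⇒precedes (τ-<-between i k i<k k<Ai)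
          ; code-before   = λ k k≡Ai → τ-<⇒precedes
              (τ-<-argmax i k (toℕ-injective (trans (sym k≡Ai) (sym (toℕ-inject₁ k)))))
          }
        }
        where
        τ-<⇒precedes : ∀ {x y} → τ′ x < τ′ y → Precedes p x y
        τ-<⇒precedes = AllPairs⇒precedes asym (Linked⇒AllPairs <-trans sorted)
                         (∈-resp-↭ (↭-sym p↭allFin) (∈-allFin _)) (∈-resp-↭ (↭-sym p↭allFin) (∈-allFin _))

≗-from-inject₁ : ∀ {m} {B : Set} (f g : Fin (suc m) → B) → f (fromℕ m) ≡ g (fromℕ m) →
                 (∀ i → f (inject₁ i) ≡ g (inject₁ i)) → ∀ x → f x ≡ g x
≗-from-inject₁ {zero}  f g top _  zero    = top
≗-from-inject₁ {suc m} f g _   eq zero    = eq zero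
≗-from-inject₁ {suc m} f g top eq (suc x) = ≗-from-inject₁ (f ∘ suc) (g ∘ suc) top (eq ∘ suc) x

open CompatiblePermutation

lemma3p7 : (ℝ : RealNumbers) → let open Geometry ℝ in
    ∀ {d m : ℕ} (u : Fin (suc m) → Pt d) (c : Pt d) →
    (∀ i → IsVertex u i) → FullDim u → CompleteGraph u →
    GenericLP u c → LabelledBy u c →
    ∀ (ω ω' : Pt d) → Generic u c ω → Generic u c ω' →
    ∀ (A A' : Fin (suc m) → Fin (suc m)) →
    IsArgmaxMap u c ω A → IsArgmaxMap u c ω' A' →
    ∀ (p p' : List (Fin m)) → IsPi u c ω A p → IsPi u c ω' A' p' →
    ((∀ i → A i ≡ A' i) ⇔ (p ≡sylv p'))
lemma3p7 ℝ u c _ _ complete _ labelled ω ω' _ _ A A' argmax argmax' p p' πp πp' = mk⇔ to from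
  where
  open LinearProgram ℝ
  cp : CompatiblePermutation (argmaxCode A) p
  cp = π-compatiblePermutation u c complete labelled argmax πp
  cp' : CompatiblePermutation (argmaxCode A') p'
  cp' = π-compatiblePermutation u c complete labelled argmax' πp'

  to : (∀ i → A i ≡ A' i) → p ≡sylv p'
  to A≗A' = compatiblePermutations-≡sylv [] p p' cp record
    { permutation = permutation cp'
    ; compatible  = compatible-resp-≗ (λ i → cong toℕ (sym (A≗A' (inject₁ i)))) (compatible cp')
    }

  from : p ≡sylv p' → ∀ i → A i ≡ A' i
  from p≡p' = ≗-from-inject₁ A A' (trans (proj₁ argmax) (sym (proj₁ argmax')))
    λ i → toℕ-injective (compatible-code-unique (unique cp'') (compatible cp'') (compatible cp')
                           (argmaxCode-≤ A) (argmaxCode-≤ A') i)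
    where
    cp'' : CompatiblePermutation (argmaxCode A) p'
    cp'' = compatiblePermutation-≡sylv p≡p' cp
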